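{- Let $p,q,r$ be fixed positive integers with $p\geq q\geq r$ and $\gcd(p,q,r)=1$. Let $t:=\gcd(p,q)$, $r_1:=p/t$, $r_2:=q/t$. Fix $M\in[n]$ divisible by $t$, and let $G_M$ be the graph with vertex set $[\lceil rM/q\rceil-1]$ in which $x$ and $y$ (possibly $x=y$, giving a loop) are adjacent whenever $px+qy=rM$. Then $G_M$ contains a collection $E$ of vertex-disjoint edges with $$|E|=\Big\lfloor \frac{rM}{r_2(p+q)}\Big\rfloor+(r_1r_2-r_1-r_2+1)\Big\lfloor \Big\lfloor \frac{rM}{r_1(p+q)}-\frac{1}{r_2}\Big\rfloor\frac{1}{r_1r_2}\Big\rfloor$$ such that at most one edge in $E$ is a loop.
   Context: $[m]=\{1,\dots,m\}$. -}

module Defs where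

open import Data.Nat as ℕ using (ℕ; zero; suc; _+_; _*_; _≤_)
open import Data.Nat.GCD using (gcd)
open import Data.Integer as ℤ using (ℤ; +_)
open import Data.Rational as ℚ using (ℚ; 0ℚ)
open import Data.Product using (_×_; proj₁; proj₂)
open import Data.Sum using (_⊎_)
open import Data.List using (List; length; filter)
open import Data.List.Relation.Unary.All using (All)
open import Data.List.Relation.Unary.AllPairs using (AllPairs)
open import Relation.Binary.PropositionalEquality using (_≡_; _≢_)

-- Natural-number division m / d (floor); only ever used with d > 0.
-- (d = 0 is mapped to 0 just to make the function total.)
_÷ℕ_ : ℕ → ℕ → ℕ
m ÷ℕ zero  = 0
m ÷ℕ suc d = m ℕ./ suc d

_//_ : ℤ → ℕ → ℚ
n // zero  = 0ℚ
n // suc d = n ℚ./ suc d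

IsVertex : (q r M : ℕ) → ℕ → Set
IsVertex q r M x = (1 ≤ x) × (+ x ℤ.≤ ℚ.ceiling ((+ (r * M)) // q) ℤ.- ℤ.+ 1)

-- Adjacency in G_M: x ~ y iff px + qy = rM (as an undirected graph, i.e.
-- also when py + qx = rM); x = y is allowed (a loop).
Adjacent : (p q r M : ℕ) → ℕ → ℕ → Set
Adjacent p q r M x y = (p * x + q * y ≡ r * M) ⊎ (p * y + q * x ≡ r * M)

IsEdge : (p q r M : ℕ) → ℕ × ℕ → Set
IsEdge p q r M e =
  IsVertex q r M (proj₁ e) × IsVertex q r M (proj₂ e)
  × Adjacent p q r M (proj₁ e) (proj₂ e)

VertexDisjoint : ℕ × ℕ → ℕ × ℕ → Set
VertexDisjoint e f =
  (proj₁ e ≢ proj₁ f) × (proj₁ e ≢ proj₂ f)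
  × (proj₂ e ≢ proj₁ f) × (proj₂ e ≢ proj₂ f)

loops : List (ℕ × ℕ) → ℕ
loops E = length (filter (λ e → proj₁ e ℕ.≟ proj₂ e) E)

IsLoopBoundedMatching : (p q r M : ℕ) → List (ℕ × ℕ) → Set
IsLoopBoundedMatching p q r M E =
  All (IsEdge p q r M) E × AllPairs VertexDisjoint E × (loops E ≤ 1)

sizeFormula : (p q r M : ℕ) → ℤ
sizeFormula p q r M =
  ℚ.floor ((+ (r * M)) // (r₂ * (p + q)))
  ℤ.+ (+ (r₁ * r₂) ℤ.- + r₁ ℤ.- + r₂ ℤ.+ ℤ.+ 1)
      ℤ.* ℚ.floor ((ℚ.floor ((+ (r * M)) // (r₁ * (p + q)) ℚ.- ((ℤ.+ 1) // r₂)) // 1)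
                   ℚ.* ((ℤ.+ 1) // (r₁ * r₂)))
  where
    t  = gcd p q
    r₁ = p ÷ℕ t
    r₂ = q ÷ℕ t

{-# OPTIONS --safe #-}
module Submission where

-- Write t = gcd p q, p = a t, q = b t and r M = N t. The edges of G_M are the solutions (u , v)
-- of a u + b v = N with u, v ≥ 1; as a and b are coprime, the first coordinates of solutions form
-- one residue class mod b and the second coordinates one class mod a. The solutions with u ≤ v are
-- pairwise vertex-disjoint with at most one loop, and there are at least A = ⌊N / (b (a + b))⌋ of
-- them. Among the solutions with v < u, indexed by v = y₀ + i a, keep those whose v is not in the
-- class of first coordinates and whose u is not in the class of second coordinates: they avoid the
-- first family, and a Chinese-remainder count over i < K b a leaves at least (a - 1) (b - 1) K of
-- them as long as (a + b) K b a a < N. The size formula is at most A + (a - 1) (b - 1) K for such a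
-- K, so a prefix of this matching has exactly the required size.

open import Data.Nat hiding (_⊔_)
open import Data.Nat.Properties
open import Data.Nat.DivMod
open import Data.Nat.Divisibility using (_∣_; divides; m∣m*n; ∣⇒≤)
open import Data.Nat.GCD using (gcd; module Bézout; gcd[m,n]∣m; gcd[m,n]∣n; gcd[m,n]≢0; m/gcd[m,n]≢0; n/gcd[m,n]≢0)
open import Data.Nat.Coprimality using (Coprime; coprime-Bézout; coprime-divisor; coprime-/gcd)
import Data.Nat.Coprimality as Coprime
import Data.Nat.Tactic.RingSolver as ℕ-Solver
open import Data.Integer as ℤ using (ℤ; +_; -[1+_]; +≤+; -≤+; _⊔_)
import Data.Integer.Properties as ℤ
import Data.Integer.DivMod as ℤ
import Data.Integer.Tactic.RingSolver as ℤ-Solver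
open import Data.Rational as ℚ using (ℚ; mkℚ; ↥_; ↧_; floor; ceiling; toℚᵘ)
import Data.Rational.Properties as ℚ
open import Data.Rational.Unnormalised as ℚᵘ using (mkℚᵘ; *≡*)
import Data.Rational.Unnormalised.Properties as ℚᵘ
open import Data.List using (List; []; _∷_; _++_; length; filter; map; concatMap; applyUpTo; upTo; take)
open import Data.List.Properties
  using (length-++; filter-++; length-applyUpTo; length-map; length-upTo; length-take; filter-all; filter-none; ++-identityʳ)
open import Data.List.Relation.Unary.All as All using (All; []; _∷_)
import Data.List.Relation.Unary.All.Properties as All
open import Data.List.Relation.Unary.AllPairs as AllPairs using (AllPairs; []; _∷_)
import Data.List.Relation.Unary.AllPairs.Properties as AllPairs
import Data.List.Relation.Unary.Unique.Propositional.Properties as Unique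
import Data.List.Relation.Binary.Sublist.Propositional.Properties as Sublist
open import Data.Product using (Σ; _×_; _,_; proj₁; proj₂)
open import Data.Sum using (inj₁; inj₂)
open import Function using (_∘_; _on_; id)
open import Level using (Level)
open import Relation.Binary.Core using (Rel)
open import Relation.Binary.PropositionalEquality hiding (J)
open import Relation.Nullary using (¬_; yes; no; ¬?)
open import Relation.Unary using (Pred; Decidable)
open import Defs

private variable
  ℓ ℓ₁ ℓ₂ ℓ₃ : Level
  A : Set ℓ₁
  B : Set ℓ₂
  C : Set ℓ₃

-- Congruences

%≡%⇒∣∸ : ∀ m n d .{{_ : NonZero d}} → m % d ≡ n % d → d ∣ m ∸ n
%≡%⇒∣∸ m n d eq = divides (m / d ∸ n / d) (begin
  m ∸ n                                     ≡⟨ cong₂ _∸_ (m≡m%n+[m/n]*n m d) (m≡m%n+[m/n]*n n d) ⟩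
  (m % d + m / d * d) ∸ (n % d + n / d * d) ≡⟨ cong (λ s → (m % d + m / d * d) ∸ (s + n / d * d)) (sym eq) ⟩
  (m % d + m / d * d) ∸ (m % d + n / d * d) ≡⟨ [m+n]∸[m+o]≡n∸o (m % d) (m / d * d) (n / d * d) ⟩
  m / d * d ∸ n / d * d                     ≡⟨ *-distribʳ-∸ d (m / d) (n / d) ⟨
  (m / d ∸ n / d) * d                       ∎)
  where open ≡-Reasoning

∣∸⇒%≡% : ∀ m n d .{{_ : NonZero d}} → d ∣ m ∸ n → d ∣ n ∸ m → m % d ≡ n % d
∣∸⇒%≡% m n d d∣m∸n d∣n∸m with ≤-total m n
... | inj₁ m≤n = sym (trans (cong (_% d) (sym (m+[n∸m]≡n m≤n))) (%-remove-+ʳ m d∣n∸m))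
... | inj₂ n≤m = trans (cong (_% d) (sym (m+[n∸m]≡n n≤m))) (%-remove-+ʳ n d∣m∸n)

module _ {d : ℕ} .{{_ : NonZero d}} where

  %-reflect : ∀ (f : ℕ → ℕ) → (∀ {x y} → d ∣ f x ∸ f y → d ∣ x ∸ y) →
              ∀ {m n} → f m % d ≡ f n % d → m % d ≡ n % d
  %-reflect f reflect {m} {n} eq =
    ∣∸⇒%≡% m n d (reflect (%≡%⇒∣∸ _ _ d eq)) (reflect (%≡%⇒∣∸ _ _ d (sym eq)))

  %-cancel-+ˡ : ∀ c {m n} → (c + m) % d ≡ (c + n) % d → m % d ≡ n % d
  %-cancel-+ˡ c = %-reflect (_+_ c) (subst (d ∣_) ([m+n]∸[m+o]≡n∸o c _ _))

  %-cancel-*ˡ : ∀ {c} → Coprime d c → ∀ {m n} → (c * m) % d ≡ (c * n) % d → m % d ≡ n % d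
  %-cancel-*ˡ {c} coprime = %-reflect (c *_)
    (λ {x} {y} d∣cx∸cy → coprime-divisor coprime (subst (d ∣_) (sym (*-distribˡ-∸ c x y)) d∣cx∸cy))

  %-cong-*ˡ : ∀ c {m n} → m % d ≡ n % d → (c * m) % d ≡ (c * n) % d
  %-cong-*ˡ c {m} {n} eq = begin
    (c * m) % d            ≡⟨ %-distribˡ-* c m d ⟩
    (c % d * (m % d)) % d  ≡⟨ cong (λ s → (c % d * s) % d) eq ⟩
    (c % d * (n % d)) % d  ≡⟨ %-distribˡ-* c n d ⟨
    (c * n) % d            ∎
    where open ≡-Reasoning

  %-cancel-+ : ∀ {m n m′ n′} → m + n ≡ m′ + n′ → m % d ≡ m′ % d → n % d ≡ n′ % d
  %-cancel-+ {m} {n} {m′} {n′} eq m≡m′ = ∣∸⇒%≡% n n′ d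
    (subst (d ∣_) (exchange m n m′ n′ eq) (%≡%⇒∣∸ m′ m d (sym m≡m′)))
    (subst (d ∣_) (exchange m′ n′ m n (sym eq)) (%≡%⇒∣∸ m m′ d m≡m′))
    where
    exchange : ∀ x y x′ y′ → x + y ≡ x′ + y′ → x′ ∸ x ≡ y ∸ y′
    exchange x y x′ y′ e = begin
      x′ ∸ x              ≡⟨ [m+n]∸[m+o]≡n∸o y′ x′ x ⟨
      y′ + x′ ∸ (y′ + x)  ≡⟨ cong₂ _∸_ (+-comm y′ x′) (+-comm y′ x) ⟩
      x′ + y′ ∸ (x + y′)  ≡⟨ cong (_∸ (x + y′)) e ⟨
      x + y ∸ (x + y′)    ≡⟨ [m+n]∸[m+o]≡n∸o x y y′ ⟩
      y ∸ y′              ∎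
      where open ≡-Reasoning

  %-injective-< : ∀ {m n} → m < d → n < d → m % d ≡ n % d → m ≡ n
  %-injective-< m<d n<d eq = trans (sym (m<n⇒m%n≡m m<d)) (trans eq (m<n⇒m%n≡m n<d))

  %-≢-window : ∀ {m n} → m < n → n < m + d → m % d ≢ n % d
  %-≢-window {m} {n} m<n n<m+d eq = <⇒≱ (m<n+o⇒m∸n<o n m n<m+d) (∣⇒≤ (%≡%⇒∣∸ n m d (sym eq)))
    where instance _ = >-nonZero (m<n⇒0<n∸m m<n)

%-representative : ∀ z d .{{_ : NonZero d}} → Σ ℕ λ x → 1 ≤ x × x ≤ d × x % d ≡ z % d
%-representative z d with z % d in eq
... | zero  = d , >-nonZero⁻¹ d , ≤-refl , n%n≡0 d
... | suc r = suc r , s≤s z≤n , subst (_≤ d) eq (m%n≤n z d) , subst (λ s → s % d ≡ s) eq (m%n%n≡m%n z d)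

*-%-solvable : ∀ a b N .{{_ : NonZero b}} → Coprime a b → Σ ℕ λ z → (a * z) % b ≡ N % b
*-%-solvable a (suc b′) N coprime with coprime-Bézout coprime
... | Bézout.+- x y eq = x * N , (begin
  (a * (x * N)) % b        ≡⟨ cong (_% b) (trans (regroup a x N) (cong (_* N) (sym eq))) ⟩
  ((1 + y * b) * N) % b    ≡⟨ cong (_% b) (expand y b N) ⟩
  (N + y * N * b) % b      ≡⟨ [m+kn]%n≡m%n N (y * N) b ⟩
  N % b                    ∎)
  where
  b = suc b′
  open ≡-Reasoning
  regroup : ∀ a x N → a * (x * N) ≡ x * a * N
  regroup = ℕ-Solver.solve-∀
  expand : ∀ y b N → (1 + y * b) * N ≡ N + y * N * b
  expand = ℕ-Solver.solve-∀
-- Here a x ≡ -1 (mod b), so multiplying by b - 1 ≡ -1 and by N gives the witness.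
... | Bézout.-+ x y eq = x * b′ * N , (begin
  (a * (x * b′ * N)) % b          ≡⟨ [m+kn]%n≡m%n (a * (x * b′ * N)) N b ⟨
  (a * (x * b′ * N) + N * b) % b  ≡⟨ cong (_% b) (expand a x b′ N) ⟩
  (N + b′ * N * (1 + x * a)) % b  ≡⟨ cong (λ s → (N + b′ * N * s) % b) eq ⟩
  (N + b′ * N * (y * b)) % b      ≡⟨ cong (λ s → (N + s) % b) (*-assoc (b′ * N) y b) ⟨
  (N + b′ * N * y * b) % b        ≡⟨ [m+kn]%n≡m%n N (b′ * N * y) b ⟩
  N % b                           ∎)
  where
  b = suc b′
  open ≡-Reasoning
  expand : ∀ a x b′ N → a * (x * b′ * N) + N * suc b′ ≡ N + b′ * N * (1 + x * a)
  expand = ℕ-Solver.solve-∀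

positive-%-solution : ∀ a b N .{{_ : NonZero b}} → Coprime a b →
                      Σ ℕ λ x → 1 ≤ x × x ≤ b × (a * x) % b ≡ N % b
positive-%-solution a b N coprime with *-%-solvable a b N coprime
... | z , az≡N with %-representative z b
... | x , 1≤x , x≤b , x≡z = x , 1≤x , x≤b , trans (%-cong-*ˡ a x≡z) az≡N

-- Counting in lists

applyUpTo-+ : ∀ (f : ℕ → A) m n → applyUpTo f (m + n) ≡ applyUpTo f m ++ applyUpTo (f ∘ (_+_ m)) n
applyUpTo-+ f zero    n = refl
applyUpTo-+ f (suc m) n = cong (f 0 ∷_) (applyUpTo-+ (f ∘ suc) m n)

AtMostOne : {A : Set ℓ₁} → Pred A ℓ → Pred (List A) (ℓ₁ Level.⊔ ℓ)
AtMostOne P = AllPairs (λ x y → ¬ (P x × P y))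

module _ {P : Pred A ℓ} (P? : Decidable P) where

  length-filter-≤1 : ∀ {xs} → AtMostOne P xs → length (filter P? xs) ≤ 1
  length-filter-≤1 {[]}     []         = z≤n
  length-filter-≤1 {x ∷ xs} (x∉ ∷ xs∉) with P? x
  ... | no  _  = length-filter-≤1 xs∉
  ... | yes px = s≤s (≤-reflexive (cong length (filter-none P? (All.map (λ x∉y py → x∉y (px , py)) x∉))))

  length-≤-suc-filter-∁ : ∀ {xs} → AtMostOne P xs → length xs ≤ suc (length (filter (¬? ∘ P?) xs))
  length-≤-suc-filter-∁ {[]}     []         = z≤n
  length-≤-suc-filter-∁ {x ∷ xs} (x∉ ∷ xs∉) with P? x
  ... | no  _  = s≤s (length-≤-suc-filter-∁ xs∉)
  ... | yes px = s≤s (≤-reflexive (cong length (sym (filter-all (¬? ∘ P?) (All.map (λ x∉y py → x∉y (px , py)) x∉)))))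


  length-filter-∁-windows : ∀ (f : ℕ → A) d K → (∀ {i j} → i < j → j < i + d → ¬ (P (f i) × P (f j))) →
                            K * (d ∸ 1) ≤ length (filter (¬? ∘ P?) (applyUpTo f (K * d)))
  length-filter-∁-windows f d zero    _       = z≤n
  length-filter-∁-windows f d (suc K) at-most = begin
    d ∸ 1 + K * (d ∸ 1)                                     ≤⟨ +-mono-≤ first-window rest ⟩
    length (filter Q? window) + length (filter Q? others)   ≡⟨ length-++ (filter Q? window) ⟨
    length (filter Q? window ++ filter Q? others)           ≡⟨ cong length (filter-++ Q? window others) ⟨
    length (filter Q? (window ++ others))                   ≡⟨ cong (length ∘ filter Q?) (applyUpTo-+ f d (K * d)) ⟨
    length (filter Q? (applyUpTo f (d + K * d)))            ∎
    where
    open ≤-Reasoning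
    Q? = ¬? ∘ P?
    window = applyUpTo f d
    others = applyUpTo (f ∘ (_+_ d)) (K * d)
    first-window : d ∸ 1 ≤ length (filter Q? window)
    first-window = subst (λ n → n ∸ 1 ≤ length (filter Q? window)) (length-applyUpTo f d)
      (∸-monoˡ-≤ 1 (length-≤-suc-filter-∁ (AllPairs.applyUpTo⁺₁ f d
        (λ i<j j<d → at-most i<j (<-≤-trans j<d (m≤n+m d _))))))
    rest : K * (d ∸ 1) ≤ length (filter Q? others)
    rest = length-filter-∁-windows (f ∘ (_+_ d)) d K
      (λ {i} {j} i<j j<i+d → at-most (+-monoʳ-< d i<j) (subst (d + j <_) (sym (+-assoc d i d)) (+-monoʳ-< d j<i+d)))

length-concatMap-≥ : ∀ (f : A → List B) {k} xs → (∀ x → k ≤ length (f x)) → length xs * k ≤ length (concatMap f xs)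
length-concatMap-≥ f []       _     = z≤n
length-concatMap-≥ f (x ∷ xs) k≤len = begin
  _ + length xs * _                       ≤⟨ +-mono-≤ (k≤len x) (length-concatMap-≥ f xs k≤len) ⟩
  length (f x) + length (concatMap f xs)  ≡⟨ length-++ (f x) ⟨
  length (f x ++ concatMap f xs)          ∎
  where open ≤-Reasoning

concatMap-AllPairs-≢ : ∀ (f : A → List B) (key : B → C) (tag : A → C) {xs} →
  (∀ x → AllPairs _≢_ (f x)) → (∀ x → All (λ u → key u ≡ tag x) (f x)) →
  AllPairs (_≢_ on tag) xs → AllPairs _≢_ (concatMap f xs)
concatMap-AllPairs-≢ f key tag f-distinct keys tags-distinct =
  AllPairs.concat⁺ (All.map⁺ (All.universal f-distinct _))
    (AllPairs.map⁺ (AllPairs.map (λ {x} {y} tx≢ty → All.map (λ ku → All.map (λ kv u≡v →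
      tx≢ty (trans (sym ku) (trans (cong key u≡v) kv))) (keys y)) (keys x)) tags-distinct))

All∧AllPairs⇒AllPairs : ∀ {P : Pred A ℓ} {R : Rel A ℓ₂} {S : Rel A ℓ₃} →
  (∀ {x y} → P x → P y → R x y → S x y) → ∀ {xs} → All P xs → AllPairs R xs → AllPairs S xs
All∧AllPairs⇒AllPairs f []         []         = []
All∧AllPairs⇒AllPairs f (px ∷ pxs) (rx ∷ rxs) =
  All.zipWith (λ (py , rxy) → f px py rxy) (pxs , rx) ∷ All∧AllPairs⇒AllPairs f pxs rxs

-- Solutions of a u + b v = N

Solution : (a b N : ℕ) → ℕ × ℕ → Set
Solution a b N e = a * proj₁ e + b * proj₂ e ≡ N

solution-swap : ∀ {a b N u v} → Solution b a N (v , u) → Solution a b N (u , v)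
solution-swap {a} {b} {u = u} {v} eq = trans (+-comm (a * u) (b * v)) eq

VertexDisjoint-swap : ∀ {u v u′ v′} → VertexDisjoint (v , u) (v′ , u′) → VertexDisjoint (u , v) (u′ , v′)
VertexDisjoint-swap (v≢v′ , v≢u′ , u≢v′ , u≢u′) = u≢u′ , u≢v′ , v≢u′ , v≢v′

module Solutions (a b N : ℕ) .{{_ : NonZero a}} .{{_ : NonZero b}} where

  FirstResidue : ℕ → Set
  FirstResidue x = (a * x) % b ≡ N % b

  SecondResidue : ℕ → Set
  SecondResidue y = (b * y) % a ≡ N % a

  solution-firstResidue : ∀ {u v} → Solution a b N (u , v) → FirstResidue u
  solution-firstResidue {u} {v} eq = trans (sym (%-remove-+ʳ (a * u) (m∣m*n v))) (cong (_% b) eq)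

  solution-secondResidue : ∀ {u v} → Solution a b N (u , v) → SecondResidue v
  solution-secondResidue {u} {v} eq = trans (sym (%-remove-+ˡ (b * v) (m∣m*n u))) (cong (_% a) eq)

  solution-injectiveˡ : ∀ {u u′ v} → Solution a b N (u , v) → Solution a b N (u′ , v) → u ≡ u′
  solution-injectiveˡ {u} {u′} {v} e f = *-cancelˡ-≡ u u′ a (+-cancelʳ-≡ (b * v) _ _ (trans e (sym f)))

  solution-injectiveʳ : ∀ {u v v′} → Solution a b N (u , v) → Solution a b N (u , v′) → v ≡ v′
  solution-injectiveʳ {u} {v} {v′} e f = *-cancelˡ-≡ v v′ b (+-cancelˡ-≡ (a * u) _ _ (trans e (sym f)))

  solution-antitone : ∀ {u v u′ v′} → Solution a b N (u , v) → Solution a b N (u′ , v′) → u ≤ u′ → v′ ≤ v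
  solution-antitone {u} {v} {u′} {v′} e f u≤u′ = *-cancelˡ-≤ b (+-cancelˡ-≤ (a * u) _ _ (begin
    a * u + b * v′  ≤⟨ +-monoˡ-≤ (b * v′) (*-monoʳ-≤ a u≤u′) ⟩
    a * u′ + b * v′ ≡⟨ trans f (sym e) ⟩
    a * u + b * v   ∎))
    where open ≤-Reasoning

  solution-≤ : ∀ {u v} → Solution a b N (u , v) → (a + b) * u ≤ N → u ≤ v
  solution-≤ {u} {v} eq small = *-cancelˡ-≤ b (+-cancelˡ-≤ (a * u) _ _
    (subst₂ _≤_ (*-distribʳ-+ u a b) (sym eq) small))

  solution-< : ∀ {u v} → Solution a b N (u , v) → (a + b) * u < N → u < v
  solution-< {u} {v} eq small = *-cancelˡ-< b u v (+-cancelˡ-< (a * u) _ _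
    (subst₂ _<_ (*-distribʳ-+ u a b) (sym eq) small))

  loop-unique : ∀ {u w} → Solution a b N (u , u) → Solution a b N (w , w) → u ≡ w
  loop-unique {u} {w} e f with ≤-total u w
  ... | inj₁ u≤w = ≤-antisym u≤w (solution-antitone e f u≤w)
  ... | inj₂ w≤u = ≤-antisym (solution-antitone f e w≤u) w≤u

  ordered-disjoint : ∀ {u v u′ v′} → Solution a b N (u , v) → Solution a b N (u′ , v′) →
                     u ≤ v → u′ ≤ v′ → u ≢ u′ → VertexDisjoint (u , v) (u′ , v′)
  ordered-disjoint {u} {v} {u′} {v′} e f u≤v u′≤v′ u≢u′ = u≢u′ , u≢v′ , v≢u′ , v≢v′
    where
    v≢v′ : v ≢ v′
    v≢v′ refl = u≢u′ (solution-injectiveˡ e f)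
    u≢v′ : u ≢ v′
    u≢v′ refl = v≢v′ (≤-antisym (solution-antitone f e u′≤v′) u≤v)
    v≢u′ : v ≢ u′
    v≢u′ refl = v≢v′ (≤-antisym u′≤v′ (solution-antitone e f u≤v))

  crossing-disjoint : ∀ {u v u′ v′} → Solution a b N (u , v) → Solution a b N (u′ , v′) →
                      u ≤ v → v′ < u′ → ¬ FirstResidue v′ → ¬ SecondResidue u′ →
                      VertexDisjoint (u , v) (u′ , v′)
  crossing-disjoint {u} {v} {u′} {v′} e f u≤v v′<u′ v′-unfit u′-unfit = u≢u′ , u≢v′ , v≢u′ , v≢v′
    where
    u≢u′ : u ≢ u′
    u≢u′ refl = <-irrefl refl (≤-<-trans u≤v (subst (_< u) (sym (solution-injectiveʳ e f)) v′<u′))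
    u≢v′ : u ≢ v′
    u≢v′ refl = v′-unfit (solution-firstResidue e)
    v≢u′ : v ≢ u′
    v≢u′ refl = u′-unfit (solution-secondResidue e)
    v≢v′ : v ≢ v′
    v≢v′ refl = <-irrefl refl (≤-<-trans u≤v (subst (v <_) (sym (solution-injectiveˡ e f)) v′<u′))

  partner : ℕ → ℕ
  partner u = (N ∸ a * u) / b

  partner-solution : ∀ {u} → FirstResidue u → (a + b) * u ≤ N → Solution a b N (u , partner u)
  partner-solution {u} au≡N small = begin
    a * u + b * ((N ∸ a * u) / b) ≡⟨ cong (_+_ (a * u)) (m*[n/m]≡n (%≡%⇒∣∸ N (a * u) b (sym au≡N))) ⟩
    a * u + (N ∸ a * u)           ≡⟨ m+[n∸m]≡n au≤N ⟩
    N                             ∎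
    where
    open ≡-Reasoning
    au≤N : a * u ≤ N
    au≤N = ≤-trans (≤-trans (m≤m+n (a * u) (b * u)) (≤-reflexive (sym (*-distribʳ-+ u a b)))) small

  progression-residue : ∀ {x₀} → FirstResidue x₀ → ∀ k → FirstResidue (x₀ + k * b)
  progression-residue {x₀} ax₀≡N k = begin
    (a * (x₀ + k * b)) % b      ≡⟨ cong (_% b) (trans (*-distribˡ-+ a x₀ (k * b)) (cong (_+_ (a * x₀)) (sym (*-assoc a k b)))) ⟩
    (a * x₀ + a * k * b) % b    ≡⟨ [m+kn]%n≡m%n (a * x₀) (a * k) b ⟩
    (a * x₀) % b                ≡⟨ ax₀≡N ⟩
    N % b                       ∎
    where open ≡-Reasoning

-- A matching of solutions

Loop : ℕ × ℕ → Set
Loop e = proj₁ e ≡ proj₂ e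

GoodEdge : (a b N : ℕ) → ℕ × ℕ → Set
GoodEdge a b N e = Solution a b N e × 1 ≤ proj₁ e × 1 ≤ proj₂ e

module Matching (a b N : ℕ) .{{_ : NonZero a}} .{{_ : NonZero b}} (coprime : Coprime a b)
  (x₀ : ℕ) (1≤x₀ : 1 ≤ x₀) (x₀≤b : x₀ ≤ b) (x₀-residue : (a * x₀) % b ≡ N % b)
  (y₀ : ℕ) (1≤y₀ : 1 ≤ y₀) (y₀≤a : y₀ ≤ a) (y₀-residue : (b * y₀) % a ≡ N % a)
  (A K : ℕ) (A-small : (a + b) * (A * b) ≤ N) (K-small : (a + b) * (K * b * a * a) < N) where

  open Solutions a b N
  module Swapped = Solutions b a N

  first : ℕ → ℕ
  first k = x₀ + k * b

  edge₁ : ℕ → ℕ × ℕ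
  edge₁ k = first k , partner (first k)

  family₁ : List (ℕ × ℕ)
  family₁ = applyUpTo edge₁ A

  first-small : ∀ {k} → k < A → (a + b) * first k ≤ N
  first-small {k} k<A = ≤-trans (*-monoʳ-≤ (a + b) (begin
    x₀ + k * b ≤⟨ +-monoˡ-≤ (k * b) x₀≤b ⟩
    b + k * b  ≤⟨ *-monoˡ-≤ b k<A ⟩
    A * b      ∎)) A-small
    where open ≤-Reasoning

  first-injective : ∀ {i j} → i < j → first i ≢ first j
  first-injective i<j = <⇒≢ (+-monoʳ-< x₀ (*-monoˡ-< b i<j))

  edge₁-solution : ∀ {k} → k < A → Solution a b N (edge₁ k)
  edge₁-solution {k} k<A = partner-solution (progression-residue x₀-residue k) (first-small k<A)

  edge₁-ordered : ∀ {k} → k < A → first k ≤ partner (first k)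
  edge₁-ordered k<A = solution-≤ (edge₁-solution k<A) (first-small k<A)

  Family₁Edge : ℕ × ℕ → Set
  Family₁Edge e = Solution a b N e × 1 ≤ proj₁ e × proj₁ e ≤ proj₂ e

  family₁-edges : All Family₁Edge family₁
  family₁-edges = All.applyUpTo⁺₁ edge₁ A
    (λ {k} k<A → edge₁-solution k<A , ≤-trans 1≤x₀ (m≤m+n x₀ (k * b)) , edge₁-ordered k<A)

  family₁-disjoint : AllPairs VertexDisjoint family₁
  family₁-disjoint = AllPairs.applyUpTo⁺₁ edge₁ A (λ i<j j<A →
    ordered-disjoint (edge₁-solution (<-trans i<j j<A)) (edge₁-solution j<A)
                     (edge₁-ordered (<-trans i<j j<A)) (edge₁-ordered j<A) (first-injective i<j))

  family₁-loops : AtMostOne Loop family₁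
  family₁-loops = AllPairs.applyUpTo⁺₁ edge₁ A (λ {i} {j} i<j j<A (loop-i , loop-j) →
    first-injective i<j (loop-unique (as-loop loop-i (edge₁-solution (<-trans i<j j<A)))
                                     (as-loop loop-j (edge₁-solution j<A))))
    where
    as-loop : ∀ {u v} → u ≡ v → Solution a b N (u , v) → Solution a b N (u , u)
    as-loop refl s = s

  second : ℕ → ℕ
  second i = y₀ + i * a

  opposite : ℕ → ℕ
  opposite i = Swapped.partner (second i)

  edge₂ : ℕ → ℕ × ℕ
  edge₂ i = opposite i , second i

  range : ℕ
  range = K * b * a

  second-small : ∀ {i} → i < range → (b + a) * second i < N
  second-small {i} i<range = subst (λ c → c * second i < N) (+-comm a b) (≤-<-trans (*-monoʳ-≤ (a + b) (begin
    y₀ + i * a ≤⟨ +-monoˡ-≤ (i * a) y₀≤a ⟩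
    a + i * a  ≤⟨ *-monoˡ-≤ a i<range ⟩
    range * a  ∎)) K-small)
    where open ≤-Reasoning

  edge₂-swapped-solution : ∀ {i} → i < range → Solution b a N (second i , opposite i)
  edge₂-swapped-solution {i} i<range =
    Swapped.partner-solution (Swapped.progression-residue y₀-residue i) (<⇒≤ (second-small i<range))

  edge₂-solution : ∀ {i} → i < range → Solution a b N (edge₂ i)
  edge₂-solution i<range = solution-swap {a} {b} (edge₂-swapped-solution i<range)

  edge₂-ordered : ∀ {i} → i < range → second i < opposite i
  edge₂-ordered i<range = Swapped.solution-< (edge₂-swapped-solution i<range) (second-small i<range)

  opposite-invariant : ∀ {i j} → i < range → j < range → b * i + opposite i ≡ b * j + opposite j
  opposite-invariant {i} {j} i<range j<range =
    *-cancelˡ-≡ _ _ a (+-cancelʳ-≡ (b * y₀) _ _ (trans (scaled i<range) (sym (scaled j<range))))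
    where
    shape : ∀ a b i o y₀ → a * (b * i + o) + b * y₀ ≡ b * (y₀ + i * a) + a * o
    shape = ℕ-Solver.solve-∀
    scaled : ∀ {i} → i < range → a * (b * i + opposite i) + b * y₀ ≡ N
    scaled {i} i<range = trans (shape a b i (opposite i) y₀) (edge₂-swapped-solution i<range)

  SecondClashes : ℕ → Set
  SecondClashes i = FirstResidue (second i)

  OppositeClashes : ℕ → Set
  OppositeClashes i = SecondResidue (opposite i)

  secondClashes? : Decidable SecondClashes
  secondClashes? i = (a * second i) % b ≟ N % b

  oppositeClashes? : Decidable OppositeClashes
  oppositeClashes? i = (b * opposite i) % a ≟ N % a

  -- An index i = x + W a lies in column x < a. Whether opposite i clashes depends only on x, and
  -- within a column at most one of any b consecutive W makes second i clash.
  column : ℕ → List ℕ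
  column x = map (λ W → x + W * a) (filter (λ W → ¬? (secondClashes? (x + W * a))) (upTo (K * b)))

  free-columns : List ℕ
  free-columns = filter (¬? ∘ oppositeClashes?) (upTo a)

  indices : List ℕ
  indices = concatMap column free-columns

  column-index-bound : ∀ {x W} → x < a → W < K * b → x + W * a < range
  column-index-bound {x} {W} x<a W<Kb = begin-strict
    x + W * a <⟨ +-monoˡ-< (W * a) x<a ⟩
    a + W * a ≤⟨ *-monoˡ-≤ a W<Kb ⟩
    range     ∎
    where open ≤-Reasoning

  opposite-column : ∀ {x W} → x + W * a < range → opposite (x + W * a) % a ≡ opposite x % a
  opposite-column {x} {W} i<range = sym (%-cancel-+
    (opposite-invariant (≤-<-trans (m≤m+n x (W * a)) i<range) i<range) (%-cong-*ˡ b (sym ([m+kn]%n≡m%n x W a))))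

  Admissible : ℕ → Set
  Admissible i = i < range × ¬ SecondClashes i × ¬ OppositeClashes i

  column-admissible : ∀ {x} → x < a → ¬ OppositeClashes x → All Admissible (column x)
  column-admissible {x} x<a x-free = All.map⁺ (All.map
    (λ {W} (W<Kb , i-free) → let i<range = column-index-bound x<a W<Kb in
      i<range , i-free , λ clash → x-free (trans (sym (%-cong-*ˡ b (opposite-column {x} {W} i<range))) clash))
    (All.zip (All.filter⁺ _ (All.all-upTo (K * b)) , All.all-filter _ (upTo (K * b)))))

  indices-admissible : All Admissible indices
  indices-admissible = All.concat⁺ (All.map⁺ (All.map (λ (x<a , x-free) → column-admissible x<a x-free)
    (All.zip (All.filter⁺ _ (All.all-upTo a) , All.all-filter _ (upTo a)))))

  indices-distinct : AllPairs _≢_ indices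
  indices-distinct = concatMap-AllPairs-≢ column (_% a) (_% a) column-distinct column-keys
    (AllPairs.filter⁺ _ (AllPairs.applyUpTo⁺₁ id a
      (λ x<y y<a eq → <⇒≢ x<y (%-injective-< (<-trans x<y y<a) y<a eq))))
    where
    column-distinct : ∀ x → AllPairs _≢_ (column x)
    column-distinct x = AllPairs.map⁺ (AllPairs.map (λ W≢W′ eq → W≢W′ (*-cancelʳ-≡ _ _ a (+-cancelˡ-≡ x _ _ eq)))
      (AllPairs.filter⁺ _ (Unique.upTo⁺ (K * b))))
    column-keys : ∀ x → All (λ i → i % a ≡ x % a) (column x)
    column-keys x = All.map⁺ (All.universal (λ W → [m+kn]%n≡m%n x W a) _)

  second-clashes : ∀ x {W W′} → W < W′ → W′ < W + b → ¬ (SecondClashes (x + W * a) × SecondClashes (x + W′ * a))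
  second-clashes x {W} {W′} W<W′ W′<W+b (clash , clash′) = %-≢-window W<W′ W′<W+b
    (%-cancel-*ˡ coprimeᵇᵃ (%-cancel-*ˡ coprimeᵇᵃ (%-cancel-+ˡ (y₀ + x * a)
      (subst₂ (λ s t → s % b ≡ t % b) (shape W) (shape W′) (%-cancel-*ˡ coprimeᵇᵃ (trans clash (sym clash′)))))))
    where
    coprimeᵇᵃ = Coprime.sym coprime
    regroup : ∀ y₀ x W a → y₀ + (x + W * a) * a ≡ y₀ + x * a + a * (a * W)
    regroup = ℕ-Solver.solve-∀
    shape : ∀ W → second (x + W * a) ≡ y₀ + x * a + a * (a * W)
    shape W = regroup y₀ x W a

  -- K > 0 makes every x < a the index of a solution.
  opposite-clashes : 0 < K → AtMostOne OppositeClashes (upTo a)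
  opposite-clashes 0<K = AllPairs.applyUpTo⁺₁ id a (λ {x} {y} x<y y<a (clash , clash′) →
    <⇒≢ x<y (%-injective-< (<-trans x<y y<a) y<a (%-cancel-*ˡ coprime
      (%-cancel-+ (comm-invariant (<-trans x<y y<a) y<a) (%-cancel-*ˡ coprime (trans clash (sym clash′)))))))
    where
    a≤range : a ≤ range
    a≤range = ≤-trans (m≤n*m a b) (*-monoˡ-≤ a (m≤n*m b K))
      where instance _ = >-nonZero 0<K
    comm-invariant : ∀ {x y} → x < a → y < a → opposite x + b * x ≡ opposite y + b * y
    comm-invariant {x} {y} x<a y<a = trans (+-comm (opposite x) (b * x))
      (trans (opposite-invariant (<-≤-trans x<a a≤range) (<-≤-trans y<a a≤range)) (+-comm (b * y) (opposite y)))

  indices-length : (a ∸ 1) * (K * (b ∸ 1)) ≤ length indices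
  indices-length = ≤-trans (free-columns-weight K opposite-clashes)
    (length-concatMap-≥ column free-columns column-length)
    where
    column-length : ∀ x → K * (b ∸ 1) ≤ length (column x)
    column-length x = subst (K * (b ∸ 1) ≤_) (sym (length-map (λ W → x + W * a) free))
      (length-filter-∁-windows clashes? id b K (second-clashes x))
      where
      clashes? = λ W → secondClashes? (x + W * a)
      free = filter (¬? ∘ clashes?) (upTo (K * b))
    free-columns-weight : ∀ k → (0 < k → AtMostOne OppositeClashes (upTo a)) →
                          (a ∸ 1) * (k * (b ∸ 1)) ≤ length free-columns * (k * (b ∸ 1))
    free-columns-weight zero    _       = ≤-reflexive (trans (*-zeroʳ (a ∸ 1)) (sym (*-zeroʳ (length free-columns))))
    free-columns-weight (suc k) at-most = *-monoˡ-≤ (suc k * (b ∸ 1))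
      (subst (λ n → n ∸ 1 ≤ length free-columns) (length-upTo a)
        (∸-monoˡ-≤ 1 (length-≤-suc-filter-∁ oppositeClashes? (at-most z<s))))

  family₂ : List (ℕ × ℕ)
  family₂ = map edge₂ indices

  Family₂Edge : ℕ × ℕ → Set
  Family₂Edge e = Solution a b N e × 1 ≤ proj₂ e × proj₂ e < proj₁ e
                × ¬ FirstResidue (proj₂ e) × ¬ SecondResidue (proj₁ e)

  family₂-edges : All Family₂Edge family₂
  family₂-edges = All.map⁺ (All.map
    (λ {i} (i<range , second-free , opposite-free) → edge₂-solution i<range , ≤-trans 1≤y₀ (m≤m+n y₀ (i * a)) ,
      edge₂-ordered i<range , second-free , opposite-free)
    indices-admissible)

  family₂-disjoint : AllPairs VertexDisjoint family₂
  family₂-disjoint = AllPairs.map⁺ (All∧AllPairs⇒AllPairs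
    (λ {i} {j} (i<range , _) (j<range , _) i≢j → VertexDisjoint-swap (Swapped.ordered-disjoint
      (edge₂-swapped-solution i<range) (edge₂-swapped-solution j<range)
      (<⇒≤ (edge₂-ordered i<range)) (<⇒≤ (edge₂-ordered j<range))
      (λ eq → i≢j (*-cancelʳ-≡ i j a (+-cancelˡ-≡ y₀ _ _ eq)))))
    indices-admissible indices-distinct)

  matching : List (ℕ × ℕ)
  matching = family₁ ++ family₂

  matching-edges : All (GoodEdge a b N) matching
  matching-edges = All.++⁺
    (All.map (λ (solution , 1≤u , u≤v) → solution , 1≤u , ≤-trans 1≤u u≤v) family₁-edges)
    (All.map (λ (solution , 1≤v , v<u , _) → solution , ≤-trans 1≤v (<⇒≤ v<u) , 1≤v) family₂-edges)

  matching-disjoint : AllPairs VertexDisjoint matching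
  matching-disjoint = AllPairs.++⁺ family₁-disjoint family₂-disjoint (All.map
    (λ (solution , _ , u≤v) → All.map
      (λ (solution′ , _ , v′<u′ , v′-free , u′-free) → crossing-disjoint solution solution′ u≤v v′<u′ v′-free u′-free)
      family₂-edges)
    family₁-edges)

  matching-loops : loops matching ≤ 1
  matching-loops = begin
    length (filter loop? (family₁ ++ family₂))           ≡⟨ cong length (filter-++ loop? family₁ family₂) ⟩
    length (filter loop? family₁ ++ filter loop? family₂) ≡⟨ cong (λ l → length (filter loop? family₁ ++ l)) no-loops₂ ⟩
    length (filter loop? family₁ ++ [])                  ≡⟨ cong length (++-identityʳ (filter loop? family₁)) ⟩
    length (filter loop? family₁)                        ≤⟨ length-filter-≤1 loop? family₁-loops ⟩
    1                                                    ∎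
    where
    open ≤-Reasoning
    loop? = λ (e : ℕ × ℕ) → proj₁ e ≟ proj₂ e
    no-loops₂ : filter loop? family₂ ≡ []
    no-loops₂ = filter-none loop? (All.map (λ (_ , _ , v<u , _) → >⇒≢ v<u) family₂-edges)

  matching-length : A + (a ∸ 1) * (K * (b ∸ 1)) ≤ length matching
  matching-length = begin
    A + (a ∸ 1) * (K * (b ∸ 1))         ≤⟨ +-monoʳ-≤ A indices-length ⟩
    A + length indices                  ≡⟨ cong₂ _+_ (length-applyUpTo edge₁ A) (length-map edge₂ indices) ⟨
    length family₁ + length family₂     ≡⟨ length-++ family₁ ⟨
    length matching                     ∎
    where open ≤-Reasoning

-- Floors of fractions

infix 4 _≐_/_

-- x ≐ i / d : x equals the fraction i / d, which need not be in lowest terms.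
data _≐_/_ (x : ℚ) (i : ℤ) (d : ℕ) : Set where
  cross : ↥ x ℤ.* + d ≡ i ℤ.* ↧ x → x ≐ i / d

private
  from-≃ : ∀ x {i d} → toℚᵘ x ℚᵘ.≃ mkℚᵘ i d → x ≐ i / suc d
  from-≃ (mkℚ _ _ _) (*≡* eq) = cross eq

  to-≃ : ∀ x {i d} → x ≐ i / suc d → toℚᵘ x ℚᵘ.≃ mkℚᵘ i d
  to-≃ (mkℚ _ _ _) (cross eq) = *≡* eq

//-≐ : ∀ i d .{{_ : NonZero d}} → i // d ≐ i / d
//-≐ i (suc d) = from-≃ (i ℚ./ suc d) (ℚ.toℚᵘ-fromℚᵘ (mkℚᵘ i d))

≐-+ : ∀ {x y i j m n} .{{_ : NonZero m}} .{{_ : NonZero n}} →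
      x ≐ i / m → y ≐ j / n → x ℚ.+ y ≐ i ℤ.* + n ℤ.+ j ℤ.* + m / m * n
≐-+ {x} {y} {m = suc _} {suc _} x≐ y≐ =
  from-≃ (x ℚ.+ y) (ℚᵘ.≃-trans (ℚ.toℚᵘ-homo-+ x y) (ℚᵘ.+-cong (to-≃ x x≐) (to-≃ y y≐)))

≐-neg : ∀ {x i d} .{{_ : NonZero d}} → x ≐ i / d → ℚ.- x ≐ ℤ.- i / d
≐-neg {x} {d = suc _} x≐ = from-≃ (ℚ.- x) (ℚᵘ.≃-trans (ℚ.toℚᵘ-homo‿- x) (ℚᵘ.-‿cong (to-≃ x x≐)))

≐-* : ∀ {x y i j m n} .{{_ : NonZero m}} .{{_ : NonZero n}} →
      x ≐ i / m → y ≐ j / n → x ℚ.* y ≐ i ℤ.* j / m * n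
≐-* {x} {y} {m = suc _} {suc _} x≐ y≐ =
  from-≃ (x ℚ.* y) (ℚᵘ.≃-trans (ℚ.toℚᵘ-homo-* x y) (ℚᵘ.*-cong (to-≃ x x≐) (to-≃ y y≐)))

floor-≤ : ∀ {x i d} → x ≐ i / d → floor x ℤ.* + d ℤ.≤ i
floor-≤ {x@(mkℚ n e _)} {i} {d} (cross eq) = ℤ.*-cancelʳ-≤-pos (floor x ℤ.* + d) i (+ suc e) (begin
  floor x ℤ.* + d ℤ.* + suc e   ≡⟨ swap (floor x) (+ d) (+ suc e) ⟩
  floor x ℤ.* + suc e ℤ.* + d   ≤⟨ ℤ.*-monoʳ-≤-nonNeg (+ d) (ℤ.[n/d]*d≤n n (+ suc e)) ⟩
  n ℤ.* + d                     ≡⟨ eq ⟩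
  i ℤ.* + suc e                 ∎)
  where
  open ℤ.≤-Reasoning
  swap : ∀ f d e → f ℤ.* d ℤ.* e ≡ f ℤ.* e ℤ.* d
  swap = ℤ-Solver.solve-∀

floor-nonNeg : ∀ x .{{_ : ℚ.NonNegative x}} → + 0 ℤ.≤ floor x
floor-nonNeg (mkℚ n e _) = ℤ.0≤n⇒0≤n/d n (+ suc e) (ℤ.nonNegative⁻¹ n) (+≤+ z≤n)

floor-//-ℕ : ∀ m d .{{_ : NonZero d}} → Σ ℕ λ k → floor ((+ m) // d) ≡ + k × k * d ≤ m
floor-//-ℕ m d@(suc _) = ℤ.∣ floor x ∣ , sym floor≡ , ℤ.drop‿+≤+ (begin
  + (ℤ.∣ floor x ∣ * d)     ≡⟨ ℤ.pos-* ℤ.∣ floor x ∣ d ⟩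
  + ℤ.∣ floor x ∣ ℤ.* + d   ≡⟨ cong (ℤ._* + d) floor≡ ⟩
  floor x ℤ.* + d           ≤⟨ floor-≤ (//-≐ (+ m) d) ⟩
  + m                       ∎)
  where
  open ℤ.≤-Reasoning
  x = (+ m) // d
  floor≡ : + ℤ.∣ floor x ∣ ≡ floor x
  floor≡ = ℤ.0≤i⇒+∣i∣≡i (floor-nonNeg x {{ℚ.normalize-nonNeg m d}})

≤-ceiling-//-1 : ∀ {m d v} .{{_ : NonZero d}} → v * d < m → + v ℤ.≤ ceiling ((+ m) // d) ℤ.- + 1
≤-ceiling-//-1 {m} {d} {v} vd<m = begin
  + v                              ≡⟨ ℤ.neg-involutive (+ v) ⟨
  ℤ.- ℤ.- + v                      ≤⟨ ℤ.neg-mono-≤ (ℤ.i<j⇒suc[i]≤j z<-v) ⟩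
  ℤ.- (+ 1 ℤ.+ z)                  ≡⟨ negate z ⟩
  ℤ.- z ℤ.- + 1                    ≡⟨ cong (ℤ._- + 1) (ceiling≡ ((+ m) // d)) ⟨
  ceiling ((+ m) // d) ℤ.- + 1     ∎
  where
  open ℤ.≤-Reasoning
  ceiling≡ : ∀ x → ceiling x ≡ ℤ.- floor (ℚ.- x)
  ceiling≡ (mkℚ _ _ _) = refl
  negate : ∀ z → ℤ.- (+ 1 ℤ.+ z) ≡ ℤ.- z ℤ.- + 1
  negate = ℤ-Solver.solve-∀
  z = floor (ℚ.- ((+ m) // d))
  z<-v : z ℤ.< ℤ.- + v
  z<-v = ℤ.*-cancelʳ-<-nonNeg (+ d) (begin-strict
    z ℤ.* + d              ≤⟨ floor-≤ (≐-neg (//-≐ (+ m) d)) ⟩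
    ℤ.- + m                <⟨ ℤ.neg-mono-< (ℤ.+<+ vd<m) ⟩
    ℤ.- + (v * d)          ≡⟨ cong ℤ.-_ (ℤ.pos-* v d) ⟩
    ℤ.- (+ v ℤ.* + d)      ≡⟨ ℤ.neg-distribˡ-* (+ v) (+ d) ⟩
    ℤ.- + v ℤ.* + d        ∎)

-- The size formula

+[m*n]-m-n+1≡+[m∸1]*[n∸1] : ∀ m n .{{_ : NonZero m}} .{{_ : NonZero n}} →
                            + (m * n) ℤ.- + m ℤ.- + n ℤ.+ + 1 ≡ + ((m ∸ 1) * (n ∸ 1))
+[m*n]-m-n+1≡+[m∸1]*[n∸1] (suc m) (suc n) = begin
  + (suc m * suc n) ℤ.- + suc m ℤ.- + suc n ℤ.+ + 1
    ≡⟨ cong (λ s → s ℤ.- + suc m ℤ.- + suc n ℤ.+ + 1) (ℤ.pos-* (suc m) (suc n)) ⟩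
  + suc m ℤ.* + suc n ℤ.- + suc m ℤ.- + suc n ℤ.+ + 1
    ≡⟨ cong₂ (λ x y → x ℤ.* y ℤ.- x ℤ.- y ℤ.+ + 1) (ℤ.pos-+ 1 m) (ℤ.pos-+ 1 n) ⟩
  (+ 1 ℤ.+ + m) ℤ.* (+ 1 ℤ.+ + n) ℤ.- (+ 1 ℤ.+ + m) ℤ.- (+ 1 ℤ.+ + n) ℤ.+ + 1
    ≡⟨ expand (+ m) (+ n) ⟩
  + m ℤ.* + n
    ≡⟨ ℤ.pos-* m n ⟨
  + (m * n)
    ∎
  where
  open ≡-Reasoning
  expand : ∀ x y → (+ 1 ℤ.+ x) ℤ.* (+ 1 ℤ.+ y) ℤ.- (+ 1 ℤ.+ x) ℤ.- (+ 1 ℤ.+ y) ℤ.+ + 1 ≡ x ℤ.* y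
  expand = ℤ-Solver.solve-∀

module SizeFormula (p q r M N t a b : ℕ) .{{_ : NonZero t}} .{{_ : NonZero a}} .{{_ : NonZero b}}
  (p≡ : a * t ≡ p) (q≡ : b * t ≡ q) (rM≡ : r * M ≡ N * t) (0<N : 0 < N) where

  -- F₁, J and T are the floors occurring in sizeFormula p q r M, with r₁ = a and r₂ = b.
  F₁ : ℤ
  F₁ = floor ((+ (r * M)) // (b * (p + q)))

  J : ℤ
  J = floor ((+ (r * M)) // (a * (p + q)) ℚ.- (+ 1) // b)

  T : ℤ
  T = floor ((J // 1) ℚ.* ((+ 1) // (a * b)))

  p+q≡ : p + q ≡ (a + b) * t
  p+q≡ = trans (cong₂ _+_ (sym p≡) (sym q≡)) (sym (*-distribʳ-+ t a b))

  instance
    a+b≢0 : NonZero (a + b)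
    a+b≢0 = >-nonZero (<-≤-trans (>-nonZero⁻¹ a) (m≤m+n a b))

    p+q≢0 : NonZero (p + q)
    p+q≢0 = subst NonZero (sym p+q≡) (m*n≢0 (a + b) t)

  F₁-bound : Σ ℕ λ A → F₁ ≡ + A × (a + b) * (A * b) ≤ N
  F₁-bound with floor-//-ℕ (r * M) (b * (p + q)) {{m*n≢0 b (p + q)}}
  ... | A , F₁≡A , A-bound = A , F₁≡A , *-cancelʳ-≤ _ N t (begin
    (a + b) * (A * b) * t    ≡⟨ regroup A b (a + b) t ⟩
    A * (b * ((a + b) * t))  ≡⟨ cong (λ s → A * (b * s)) p+q≡ ⟨
    A * (b * (p + q))        ≤⟨ A-bound ⟩
    r * M                    ≡⟨ rM≡ ⟩
    N * t                    ∎)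
    where
    open ≤-Reasoning
    regroup : ∀ A b s t → s * (A * b) * t ≡ A * (b * (s * t))
    regroup = ℕ-Solver.solve-∀

  J-bound : J ℤ.* + (a * (p + q) * b) ℤ.+ + (a * (p + q)) ℤ.≤ + (r * M) ℤ.* + b
  J-bound = begin
    J ℤ.* + (D * b) ℤ.+ + D                            ≤⟨ ℤ.+-monoˡ-≤ (+ D) (floor-≤ (≐-+ (//-≐ (+ (r * M)) D) (≐-neg (//-≐ (+ 1) b)))) ⟩
    + (r * M) ℤ.* + b ℤ.+ ℤ.- + 1 ℤ.* + D ℤ.+ + D      ≡⟨ cancel (+ (r * M) ℤ.* + b) (+ D) ⟩
    + (r * M) ℤ.* + b                                  ∎
    where
    open ℤ.≤-Reasoning
    D = a * (p + q)
    instance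
      D≢0 : NonZero D
      D≢0 = m*n≢0 a (p + q)
    cancel : ∀ x d → x ℤ.+ ℤ.- + 1 ℤ.* d ℤ.+ d ≡ x
    cancel = ℤ-Solver.solve-∀

  T-bound : T ℤ.* + (a * b) ℤ.≤ J
  T-bound = subst₂ ℤ._≤_ (cong (λ n → T ℤ.* + n) (*-identityˡ (a * b))) (ℤ.*-identityʳ J)
    (floor-≤ (≐-* (//-≐ J 1) (//-≐ (+ 1) (a * b))))
    where instance _ = m*n≢0 a b

  K≤T⇒bound : ∀ K → + K ℤ.≤ T → K * (a * b) * (a * (p + q) * b) + a * (p + q) ≤ r * M * b
  K≤T⇒bound K K≤T = ℤ.drop‿+≤+ (begin
    + (K * (a * b) * (D * b) + D)               ≡⟨ ℤ.pos-+ (K * (a * b) * (D * b)) D ⟩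
    + (K * (a * b) * (D * b)) ℤ.+ + D           ≡⟨ cong (ℤ._+ + D) (ℤ.pos-* (K * (a * b)) (D * b)) ⟩
    + (K * (a * b)) ℤ.* + (D * b) ℤ.+ + D       ≤⟨ ℤ.+-monoˡ-≤ (+ D) (ℤ.*-monoʳ-≤-nonNeg (+ (D * b)) K·ab≤J) ⟩
    J ℤ.* + (D * b) ℤ.+ + D                     ≤⟨ J-bound ⟩
    + (r * M) ℤ.* + b                           ≡⟨ ℤ.pos-* (r * M) b ⟨
    + (r * M * b)                               ∎)
    where
    open ℤ.≤-Reasoning
    D = a * (p + q)
    K·ab≤J : + (K * (a * b)) ℤ.≤ J
    K·ab≤J = begin
      + (K * (a * b))        ≡⟨ ℤ.pos-* K (a * b) ⟩
      + K ℤ.* + (a * b)      ≤⟨ ℤ.*-monoʳ-≤-nonNeg (+ (a * b)) K≤T ⟩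
      T ℤ.* + (a * b)        ≤⟨ T-bound ⟩
      J                      ∎

  K≤T⇒small : ∀ K → + K ℤ.≤ T → (a + b) * (K * b * a * a) < N
  K≤T⇒small K K≤T = *-cancelʳ-< b _ N (begin-strict
    (a + b) * (K * b * a * a) * b                       ≡⟨ regroup K a b ⟩
    K * (a * b) * (a * (a + b)) * b                     <⟨ m<m+n _ (>-nonZero⁻¹ (a * (a + b))) ⟩
    K * (a * b) * (a * (a + b)) * b + a * (a + b)       ≤⟨ *-cancelʳ-≤ _ _ t scaled ⟩
    N * b                                               ∎)
    where
    open ≤-Reasoning
    instance
      a[a+b]≢0 : NonZero (a * (a + b))
      a[a+b]≢0 = m*n≢0 a (a + b)
    regroup : ∀ K a b → (a + b) * (K * b * a * a) * b ≡ K * (a * b) * (a * (a + b)) * b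
    regroup = ℕ-Solver.solve-∀
    distribute : ∀ K a b s t → (K * (a * b) * (a * s) * b + a * s) * t
                             ≡ K * (a * b) * (a * (s * t) * b) + a * (s * t)
    distribute = ℕ-Solver.solve-∀
    swap : ∀ N t b → N * t * b ≡ N * b * t
    swap = ℕ-Solver.solve-∀
    scaled : (K * (a * b) * (a * (a + b)) * b + a * (a + b)) * t ≤ N * b * t
    scaled = begin
      (K * (a * b) * (a * (a + b)) * b + a * (a + b)) * t            ≡⟨ distribute K a b (a + b) t ⟩
      K * (a * b) * (a * ((a + b) * t) * b) + a * ((a + b) * t)      ≡⟨ cong (λ s → K * (a * b) * (a * s * b) + a * s) p+q≡ ⟨
      K * (a * b) * (a * (p + q) * b) + a * (p + q)                  ≤⟨ K≤T⇒bound K K≤T ⟩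
      r * M * b                                                      ≡⟨ cong (_* b) rM≡ ⟩
      N * t * b                                                      ≡⟨ swap N t b ⟩
      N * b * t                                                      ∎

  T-majorant : Σ ℕ λ K → T ℤ.≤ + K × (a + b) * (K * b * a * a) < N
  T-majorant with T in T≡
  ... | + K      = K , ℤ.≤-refl , K≤T⇒small K (ℤ.≤-reflexive (sym T≡))
  ... | -[1+ _ ] = 0 , -≤+ , subst (_< N) (sym (*-zeroʳ (a + b))) 0<N

  size-bound : Σ ℕ λ A → Σ ℕ λ K → (a + b) * (A * b) ≤ N × (a + b) * (K * b * a * a) < N
             × F₁ ℤ.+ (+ (a * b) ℤ.- + a ℤ.- + b ℤ.+ + 1) ℤ.* T ℤ.≤ + (A + (a ∸ 1) * (K * (b ∸ 1)))
  size-bound with F₁-bound | T-majorant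
  ... | A , F₁≡A , A-small | K , T≤K , K-small = A , K , A-small , K-small , (begin
    F₁ ℤ.+ (+ (a * b) ℤ.- + a ℤ.- + b ℤ.+ + 1) ℤ.* T   ≡⟨ cong₂ (λ x c → x ℤ.+ c ℤ.* T) F₁≡A (+[m*n]-m-n+1≡+[m∸1]*[n∸1] a b) ⟩
    + A ℤ.+ + c ℤ.* T                                  ≤⟨ ℤ.+-monoʳ-≤ (+ A) (ℤ.*-monoˡ-≤-nonNeg (+ c) T≤K) ⟩
    + A ℤ.+ + c ℤ.* + K                                ≡⟨ cong (ℤ._+_ (+ A)) (ℤ.pos-* c K) ⟨
    + A ℤ.+ + (c * K)                                  ≡⟨ ℤ.pos-+ A (c * K) ⟨
    + (A + c * K)                                      ≡⟨ cong (λ n → + (A + n)) (reorder (a ∸ 1) (b ∸ 1) K) ⟩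
    + (A + (a ∸ 1) * (K * (b ∸ 1)))                    ∎)
    where
    open ℤ.≤-Reasoning
    c = (a ∸ 1) * (b ∸ 1)
    reorder : ∀ x y K → x * y * K ≡ x * (K * y)
    reorder = ℕ-Solver.solve-∀

loops-take : ∀ n E → loops (take n E) ≤ loops E
loops-take n E = Sublist.length-mono-≤ (Sublist.filter⁺ loop? loop? (λ { refl l → l }) (Sublist.take-⊆ n E))
  where loop? = λ (e : ℕ × ℕ) → proj₁ e ≟ proj₂ e

take-matching : ∀ {p q r M} E {F : ℤ} → IsLoopBoundedMatching p q r M E → F ℤ.≤ + length E →
                Σ (List (ℕ × ℕ)) λ E′ → IsLoopBoundedMatching p q r M E′ × + length E′ ≡ F ⊔ + 0
take-matching E {F} (edges , disjoint , few-loops) F≤len =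
  take n E , (All.take⁺ n edges , AllPairs.take⁺ n disjoint , ≤-trans (loops-take n E) few-loops) ,
  trans (cong +_ (trans (length-take n E) (m≤n⇒m⊓n≡m n≤len))) +n≡
  where
  n = ℤ.∣ F ⊔ + 0 ∣
  +n≡ : + n ≡ F ⊔ + 0
  +n≡ = ℤ.0≤i⇒+∣i∣≡i (ℤ.i≤j⊔i F (+ 0))
  n≤len : n ≤ length E
  n≤len = ℤ.drop‿+≤+ (subst (ℤ._≤ + length E) (sym +n≡) (ℤ.⊔-lub F≤len (+≤+ z≤n)))

module Reduction (p q r M N t a b : ℕ) .{{_ : NonZero t}} .{{_ : NonZero a}} .{{_ : NonZero b}}
  (p≡ : a * t ≡ p) (q≡ : b * t ≡ q) (rM≡ : r * M ≡ N * t) (b≤a : b ≤ a) (coprime : Coprime a b) (0<N : 0 < N) where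

  open SizeFormula p q r M N t a b p≡ q≡ rM≡ 0<N

  private instance
    q≢0 : NonZero q
    q≢0 = subst NonZero q≡ (m*n≢0 b t)

  GoodEdge⇒IsEdge : ∀ {e} → GoodEdge a b N e → IsEdge p q r M e
  GoodEdge⇒IsEdge {u , v} (solution , 1≤u , 1≤v) = (1≤u , vertex bu<N) , (1≤v , vertex bv<N) , inj₁ adjacent
    where
    open ≤-Reasoning
    bu<N : b * u < N
    bu<N = begin-strict
      b * u          ≤⟨ *-monoˡ-≤ u b≤a ⟩
      a * u          <⟨ m<m+n (a * u) (*-mono-≤ (>-nonZero⁻¹ b) 1≤v) ⟩
      a * u + b * v  ≡⟨ solution ⟩
      N              ∎
    bv<N : b * v < N
    bv<N = begin-strict
      b * v          <⟨ m<n+m (b * v) (*-mono-≤ (>-nonZero⁻¹ a) 1≤u) ⟩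
      a * u + b * v  ≡⟨ solution ⟩
      N              ∎
    vertex : ∀ {x} → b * x < N → + x ℤ.≤ ceiling ((+ (r * M)) // q) ℤ.- + 1
    vertex {x} bx<N = ≤-ceiling-//-1 (begin-strict
      x * q        ≡⟨ cong (x *_) q≡ ⟨
      x * (b * t)  ≡⟨ rearrange x b t ⟩
      b * x * t    <⟨ *-monoˡ-< t bx<N ⟩
      N * t        ≡⟨ rM≡ ⟨
      r * M        ∎)
      where
      rearrange : ∀ x b t → x * (b * t) ≡ b * x * t
      rearrange = ℕ-Solver.solve-∀
    adjacent : p * u + q * v ≡ r * M
    adjacent = begin-equality
      p * u + q * v          ≡⟨ cong₂ (λ x y → x * u + y * v) p≡ q≡ ⟨
      a * t * u + b * t * v  ≡⟨ factor a t u b v ⟩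
      (a * u + b * v) * t    ≡⟨ cong (_* t) solution ⟩
      N * t                  ≡⟨ rM≡ ⟨
      r * M                  ∎
      where
      factor : ∀ a t u b v → a * t * u + b * t * v ≡ (a * u + b * v) * t
      factor = ℕ-Solver.solve-∀

  exact-matching : Σ (List (ℕ × ℕ)) λ E → IsLoopBoundedMatching p q r M E
                   × + length E ≡ (F₁ ℤ.+ (+ (a * b) ℤ.- + a ℤ.- + b ℤ.+ + 1) ℤ.* T) ⊔ + 0
  exact-matching with size-bound | positive-%-solution a b N coprime | positive-%-solution b a N (Coprime.sym coprime)
  ... | A , K , A-small , K-small , formula≤ | x₀ , 1≤x₀ , x₀≤b , x₀-residue | y₀ , 1≤y₀ , y₀≤a , y₀-residue =
    take-matching {p} {q} {r} {M} matching (All.map GoodEdge⇒IsEdge matching-edges , matching-disjoint , matching-loops)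
      (ℤ.≤-trans formula≤ (+≤+ matching-length))
    where
    open Matching a b N coprime x₀ 1≤x₀ x₀≤b x₀-residue y₀ 1≤y₀ y₀≤a y₀-residue A K A-small K-small

÷ℕ≡/ : ∀ m d .{{_ : NonZero d}} → m ÷ℕ d ≡ m / d
÷ℕ≡/ m (suc d) = refl

module Quotients (p q : ℕ) .{{_ : NonZero q}} (q≤p : q ≤ p) where

  t : ℕ
  t = gcd p q

  a : ℕ
  a = p ÷ℕ t

  b : ℕ
  b = q ÷ℕ t

  private instance
    p≢0 : NonZero p
    p≢0 = >-nonZero (<-≤-trans (>-nonZero⁻¹ q) q≤p)

  instance
    t≢0 : NonZero t
    t≢0 = ≢-nonZero (gcd[m,n]≢0 p q (inj₂ (≢-nonZero⁻¹ q)))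

    a≢0 : NonZero a
    a≢0 = subst NonZero (sym (÷ℕ≡/ p t)) (≢-nonZero (m/gcd[m,n]≢0 p q))

    b≢0 : NonZero b
    b≢0 = subst NonZero (sym (÷ℕ≡/ q t)) (≢-nonZero (n/gcd[m,n]≢0 p q))

  ÷ℕ-*-cancel : ∀ x → t ∣ x → x ÷ℕ t * t ≡ x
  ÷ℕ-*-cancel x t∣x = trans (cong (_* t) (÷ℕ≡/ x t)) (m/n*n≡m t∣x)

  a*t≡p : a * t ≡ p
  a*t≡p = ÷ℕ-*-cancel p (gcd[m,n]∣m p q)

  b*t≡q : b * t ≡ q
  b*t≡q = ÷ℕ-*-cancel q (gcd[m,n]∣n p q)

  b≤a : b ≤ a
  b≤a = subst₂ _≤_ (sym (÷ℕ≡/ q t)) (sym (÷ℕ≡/ p t)) (/-monoˡ-≤ t q≤p)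

  coprime : Coprime a b
  coprime = subst₂ Coprime (sym (÷ℕ≡/ p t)) (sym (÷ℕ≡/ q t)) (coprime-/gcd p q)

lemma2p5 : (n p q r M : ℕ) → 0 < r → r ≤ q → q ≤ p → gcd (gcd p q) r ≡ 1
    → 1 ≤ M → M ≤ n → gcd p q ∣ M
    → Σ (List (ℕ × ℕ)) λ E → IsLoopBoundedMatching p q r M E
        × (+ length E ≡ sizeFormula p q r M ⊔ + 0)
lemma2p5 n p q r M 0<r r≤q q≤p _ 1≤M _ (divides m M≡m*t) =
  Reduction.exact-matching p q r M (r * m) t a b a*t≡p b*t≡q rM≡rm*t b≤a coprime 0<r*m
  where
  instance
    q≢0 : NonZero q
    q≢0 = >-nonZero (<-≤-trans 0<r r≤q)
  open Quotients p q q≤p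
  rM≡rm*t : r * M ≡ r * m * t
  rM≡rm*t = trans (cong (r *_) M≡m*t) (sym (*-assoc r m t))
  0<r*m : 0 < r * m
  0<r*m = *-mono-≤ 0<r (>-nonZero⁻¹ m {{m*n≢0⇒m≢0 m {{subst NonZero M≡m*t (>-nonZero 1≤M)}}}})
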